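{- Let $a_1x_1+\cdots+a_nx_n\leqslant a_0$ be a linear integer constraint with positive integer coefficients and integer variables $x_i\in[0,d_i]$, let $\mathcal M$ be its MDD with root $\mu$, and let $F$ be the MDD encoding formula described in the context. Let $i\in\{1,\dots,n\}$, let $v_j\in[0,d_j]$ for $i\leqslant j\leqslant n$, and let $A$ be the partial assignment setting $y_j^k$ true for all $i\leqslant j\leqslant n$ and $1\leqslant k\leqslant v_j$ (i.e. encoding $x_j\geqslant v_j$ for $j\ge i$). Let $\nu$ be a node of $\mathcal M$ with selector variable $x_i$. Then unit propagation on $F$ together with $A$ assigns $z_\nu$ to false if and only if $A$ is incompatible with $\nu$, i.e. there is no $(w_i,\dots,w_n)$ with $v_j\leqslant w_j\leqslant d_j$ for all $j\ge i$ such that $f_\nu(w_i,\dots,w_n)$ is true.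
   Context: The MDD of the constraint is the quasi-reduced ordered multi-valued decision diagram without long edges, with variable order $x_1,\dots,x_n$, representing the constraint: it has terminal nodes $\mathcal T$ (true) and $\mathcal F$ (false); each non-terminal node $\nu$ has a selector variable $x_i$ and children $\mathrm{child}(\nu,r)$, $0\le r\le d_i$, which have selector $x_{i+1}$ (or are terminals if $i=n$). A node $\nu$ with selector $x_i$ represents the Boolean function $f_\nu(x_i,\dots,x_n)=f_{\mathrm{child}(\nu,x_i)}(x_{i+1},\dots,x_n)$, with $f_{\mathcal T}\equiv$ true, $f_{\mathcal F}\equiv$ false. Order encoding: for each $i$ and $1\le k\le d_i$ a Boolean variable $y_i^k$ meaning $x_i\geqslant k$, with clauses $y_i^{k+1}\rightarrow y_i^k$; $y_i^0$ denotes the constant true. MDD encoding formula $F$: the order-encoding clauses, one Boolean variable $z_\nu$ per node $\nu$, the unit clauses $z_{\mathcal T}$ and $\neg z_{\mathcal F}$, and for every non-terminal node $\nu$ with selector $x_i$ and every $0\le j\le d_i$ the clause $\neg z_\nu\lor\neg y_i^j\lor z_{\mathrm{child}(\nu,j)}$. -}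

module Defs where

open import Data.Nat using (ℕ; zero; suc; _+_; _*_; _∸_; _≤_)
open import Data.Integer as ℤ using (ℤ; +_)
open import Data.Bool using (Bool; true; false)
open import Data.Empty using (⊥)
open import Data.List using (List; []; _∷_)
open import Data.List.Membership.Propositional using (_∈_)
open import Relation.Binary.PropositionalEquality using (_≡_; _≢_)
open import Function.Bundles using (_⇔_)

-- Conventions.
-- Variables are x_1 … x_n (1-based); domains, coefficients and
-- assignments are functions ℕ → ℕ of which only indices 1..n matter.
-- Domain of x_j is [0, d j].

linSum : ℕ → (ℕ → ℕ) → (ℕ → ℕ) → ℕ
linSum zero    a w = 0
linSum (suc m) a w = linSum m a w + a (suc m) * w (suc m)

InDom : (d : ℕ → ℕ) (lo n : ℕ) → (ℕ → ℕ) → Set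
InDom d lo n w = ∀ j → lo ≤ j → j ≤ n → w j ≤ d j

-- Layered ordered MDD without long edges.
-- Nodes are stored by the number of remaining variables:
--   Lvl I 0       = Bool  : the two terminals (true = 𝒯, false = ℱ)
--   Lvl I (suc k) = I k   : non-terminal nodes with k+1 remaining
--                           variables, i.e. with selector x_{n-k}.

Lvl : (ℕ → Set) → ℕ → Set
Lvl I zero    = Bool
Lvl I (suc k) = I k

record MDD (n : ℕ) (d : ℕ → ℕ) : Set₁ where
  field
    Inner : ℕ → Set
    -- child ν r, meaningful for 0 ≤ r ≤ d (selector index)
    child : ∀ {k} → Inner k → ℕ → Lvl Inner k
    root  : Lvl Inner n

module _ {n : ℕ} {d : ℕ → ℕ} (M : MDD n d) where
  open MDD M

  sel : ℕ → ℕ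
  sel k = n ∸ k

  eval : (k : ℕ) → Lvl Inner k → (ℕ → ℕ) → Bool
  eval zero    b w = b
  eval (suc k) ν w = eval k (child ν (w (sel k))) w

  data Reach : (k : ℕ) → Lvl Inner k → Set where
    reach-root  : Reach n root
    reach-child : ∀ {k} {ν : Inner k} (r : ℕ) → r ≤ d (sel k) →
                  Reach (suc k) ν → Reach k (child ν r)

  data Var : Set where
    y : ℕ → ℕ → Var                 -- y j k  means  x_j ≥ k   (k ≥ 1)
    z : (k : ℕ) → Lvl Inner k → Var

  data Lit : Set where
    pos neg : Var → Lit

  compl : Lit → Lit
  compl (pos x) = neg x
  compl (neg x) = pos x

  -- membership of a clause in F.  y_i^0 is the constant true, so the
  -- literal ¬y_i^0 is omitted from the j = 0 edge clauses.
  data Clause : List Lit → Set where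
    order  : ∀ j k → 1 ≤ j → j ≤ n → 1 ≤ k → suc k ≤ d j →
             Clause (neg (y j (suc k)) ∷ pos (y j k) ∷ [])
    unitT  : Clause (pos (z 0 true) ∷ [])
    unitF  : Clause (neg (z 0 false) ∷ [])
    edge0  : ∀ {k} (ν : Inner k) →
             Clause (neg (z (suc k) ν) ∷ pos (z k (child ν 0)) ∷ [])
    edge   : ∀ {k} (ν : Inner k) (j : ℕ) → 1 ≤ j → j ≤ d (sel k) →
             Clause (neg (z (suc k) ν) ∷ neg (y (sel k) j) ∷ pos (z k (child ν j)) ∷ [])

  -- Literals set by unit propagation on F together with a partial
  -- assignment A (given as the set of literals it makes true):
  -- least set containing A and closed under the unit rule.
  data UP (A : Lit → Set) : Lit → Set where
    assumed   : ∀ {l} → A l → UP A l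
    propagate : ∀ {l} (C : List Lit) → Clause C → l ∈ C →
                (∀ l' → l' ∈ C → l' ≢ l → UP A (compl l')) → UP A l

  data AssignA (i : ℕ) (v : ℕ → ℕ) : Lit → Set where
    setY : ∀ j k → i ≤ j → j ≤ n → 1 ≤ k → k ≤ v j → AssignA i v (pos (y j k))

record IsMDDOf {n : ℕ} {d : ℕ → ℕ} (M : MDD n d) (a : ℕ → ℕ) (a0 : ℤ) : Set where
  open MDD M
  field
    represents : ∀ w → InDom d 1 n w →
                 (eval M n root w ≡ true) ⇔ (+ linSum n a w ℤ.≤ a0)
    noExtra    : ∀ k → n ≤ k → Inner k → ⊥
    reachable  : ∀ k (ν : Inner k) → Reach M (suc k) ν
    reduced    : ∀ k (ν μ : Inner k) →
                 (∀ w → InDom d (n ∸ k) n w → eval M (suc k) ν w ≡ eval M (suc k) μ w) →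
                 ν ≡ μ

Incompatible : ∀ {n d} (M : MDD n d) (i : ℕ) (v : ℕ → ℕ) {k : ℕ} → MDD.Inner M k → Set
Incompatible {n} {d} M i v {k} ν =
  (w : ℕ → ℕ) → (∀ j → i ≤ j → j ≤ n → v j ≤ w j) → InDom d i n w →
  eval M (suc k) ν w ≡ true → ⊥

module Submission where

-- Unit propagation is sound: every literal it derives holds in every model of F ∪ A.
-- For w ≥ v in the domain, putting y_j^k := (w_j ≥ k) and z_μ := f_μ(w) gives such a
-- model; its edge clauses hold because every f_μ is antitone on the domain, which
-- follows from a_j ≥ 0 by completing w with the labels of a path from the root to μ.
-- So a derived ¬z_ν makes f_ν false on every such w.  Conversely, if f_ν(v) is false,
-- the path of v from ν ends in ℱ, and the edge clauses ¬z_μ ∨ ¬y^{v_j} ∨ z_child along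
-- it propagate ¬z_ℱ back up to ¬z_ν.

open import Defs
open import Data.Nat using (ℕ; zero; suc; _∸_; _≤_; _<_; z≤n; s≤s; s≤s⁻¹; _≟_; _≤?_; _<?_)
open import Data.Nat.Properties
open import Data.Integer using (ℤ; +_; +≤+) renaming (_≤_ to _≤ℤ_)
open import Data.Integer.Properties using () renaming (≤-trans to ℤ≤-trans)
open import Data.Bool using (Bool; true; false)
open import Data.Bool.Properties using (¬-not) renaming (_≟_ to _≟ᵇ_)
open import Data.Empty using (⊥-elim)
open import Data.Product using (∃; _×_; _,_)
open import Data.List.Relation.Unary.Any using (Any; here; there)
open import Data.List.Membership.Propositional using (find)
open import Relation.Nullary using (Dec; yes; no; ¬_; does; contradiction)
open import Relation.Nullary.Decidable using (dec-true; dec-false)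
open import Relation.Binary.PropositionalEquality
open import Function.Bundles using (_⇔_; mk⇔; Equivalence)

update : (ℕ → ℕ) → ℕ → ℕ → ℕ → ℕ
update w p r j with j ≟ p
... | yes _ = r
... | no _  = w j

update-updates : ∀ w p r → update w p r p ≡ r
update-updates w p r with p ≟ p
... | yes _   = refl
... | no p≢p  = ⊥-elim (p≢p refl)

update-minimal : ∀ w p r j → j ≢ p → update w p r j ≡ w j
update-minimal w p r j j≢p with j ≟ p
... | yes j≡p = ⊥-elim (j≢p j≡p)
... | no _    = refl

splice : ℕ → (ℕ → ℕ) → (ℕ → ℕ) → ℕ → ℕ
splice c p u j with j <? c
... | yes _ = p j
... | no _  = u j

splice-< : ∀ c p u j → j < c → splice c p u j ≡ p j
splice-< c p u j j<c with j <? c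
... | yes _   = refl
... | no j≮c  = ⊥-elim (j≮c j<c)

splice-≥ : ∀ c p u j → c ≤ j → splice c p u j ≡ u j
splice-≥ c p u j c≤j with j <? c
... | yes j<c = ⊥-elim (<⇒≱ j<c c≤j)
... | no _    = refl

-- InDom u lo n w states that w ≤ u pointwise on [lo, n], for any bound u.
InDom-trans : ∀ {d u lo n w} → InDom u lo n w → InDom d lo n u → InDom d lo n w
InDom-trans w≤u u≤d j lo≤j j≤n = ≤-trans (w≤u j lo≤j j≤n) (u≤d j lo≤j j≤n)

update-≤ : ∀ w p r n → r ≤ w p → InDom w 1 n (update w p r)
update-≤ w p r n r≤wp j _ _ with j ≟ p
... | yes refl = r≤wp
... | no _     = ≤-refl

splice-InDom : ∀ {d n c p u} → InDom d 1 n p → InDom d c n u → InDom d 1 n (splice c p u)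
splice-InDom {c = c} p≤d u≤d j 1≤j j≤n with j <? c
... | yes _   = p≤d j 1≤j j≤n
... | no j≮c  = u≤d j (≮⇒≥ j≮c) j≤n

splice-monoʳ : ∀ {n} c p {u u'} → InDom u' 1 n u → InDom (splice c p u') 1 n (splice c p u)
splice-monoʳ c p u≤u' j 1≤j j≤n with j <? c
... | yes _ = ≤-refl
... | no _  = u≤u' j 1≤j j≤n

linSum-mono-≤ : ∀ m a {w w'} → InDom w' 1 m w → linSum m a w ≤ linSum m a w'
linSum-mono-≤ zero    a w≤w' = z≤n
linSum-mono-≤ (suc m) a w≤w' =
  +-mono-≤ (linSum-mono-≤ m a (λ j 1≤j j≤m → w≤w' j 1≤j (m≤n⇒m≤1+n j≤m)))
           (*-monoʳ-≤ (a (suc m)) (w≤w' (suc m) (s≤s z≤n) ≤-refl))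

∸-≤-swap : ∀ {i k n} → i ≤ n → k ≤ n ∸ i → i ≤ n ∸ k
∸-≤-swap {i} {k} {n} i≤n k≤n∸i = begin
  i            ≡⟨ m∸[m∸n]≡n i≤n ⟨
  n ∸ (n ∸ i)  ≤⟨ ∸-monoʳ-≤ n k≤n∸i ⟩
  n ∸ k        ∎
  where open ≤-Reasoning

module MDDSemantics {n : ℕ} {d : ℕ → ℕ} (M : MDD n d) where
  open MDD M

  eval-local : ∀ k (μ : Lvl Inner k) {w w'} →
               (∀ k' → k' < k → w (n ∸ k') ≡ w' (n ∸ k')) → eval M k μ w ≡ eval M k μ w'
  eval-local zero    μ     agree = refl
  eval-local (suc k) ν {w} agree rewrite agree k ≤-refl =
    eval-local k (child ν _) (λ k' k'<k → agree k' (m≤n⇒m≤1+n k'<k))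

  reach-level-≤ : ∀ {k} {μ : Lvl Inner k} → Reach M k μ → k ≤ n
  reach-level-≤ reach-root               = ≤-refl
  reach-level-≤ (reach-child {k} _ _ R) = ≤-trans (n≤1+n k) (reach-level-≤ R)

  -- p records the labels of a path from the root to μ
  reach-path : ∀ {k} {μ : Lvl Inner k} → Reach M k μ →
               ∃ λ p → InDom d 1 n p ×
                 (∀ w → (∀ j → j ≤ n ∸ k → w j ≡ p j) → eval M n root w ≡ eval M k μ w)
  reach-path reach-root = (λ _ → 0) , (λ _ _ _ → z≤n) , (λ _ _ → refl)
  reach-path (reach-child {k} {ν} r r≤d R) with reach-path R
  ... | p , p≤d , root≡ν = update p (n ∸ k) r , p'≤d , root≡child
    where
    k<n : k < n
    k<n = reach-level-≤ R

    p'≤d : InDom d 1 n (update p (n ∸ k) r)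
    p'≤d j 1≤j j≤n with j ≟ n ∸ k
    ... | yes refl = r≤d
    ... | no _     = p≤d j 1≤j j≤n

    root≡child : ∀ w → (∀ j → j ≤ n ∸ k → w j ≡ update p (n ∸ k) r j) →
                 eval M n root w ≡ eval M k (child ν r) w
    root≡child w w≡p' = begin
      eval M n root w                     ≡⟨ root≡ν w w≡p ⟩
      eval M k (child ν (w (n ∸ k))) w    ≡⟨ cong (λ t → eval M k (child ν t) w) w[n∸k]≡r ⟩
      eval M k (child ν r) w              ∎
      where
      open ≡-Reasoning
      n∸sk<n∸k : n ∸ suc k < n ∸ k
      n∸sk<n∸k = ∸-monoʳ-< ≤-refl k<n
      w≡p : ∀ j → j ≤ n ∸ suc k → w j ≡ p j
      w≡p j j≤ = trans (w≡p' j (≤-trans j≤ (<⇒≤ n∸sk<n∸k)))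
                       (update-minimal p (n ∸ k) r j (<⇒≢ (≤-<-trans j≤ n∸sk<n∸k)))
      w[n∸k]≡r : w (n ∸ k) ≡ r
      w[n∸k]≡r = trans (w≡p' (n ∸ k) ≤-refl) (update-updates p (n ∸ k) r)

  module _ {a : ℕ → ℕ} {a0 : ℤ} (isM : IsMDDOf M a a0) where
    open IsMDDOf isM

    -- Splicing both assignments into the path to μ turns a comparison at μ into one
    -- at the root, where it is the monotonicity of the linear sum.
    eval-antitone : ∀ {k} {μ : Lvl Inner k} → Reach M k μ → ∀ {w w'} →
                    InDom d 1 n w' → InDom w' 1 n w →
                    eval M k μ w' ≡ true → eval M k μ w ≡ true
    eval-antitone {k} {μ} R {w} {w'} w'≤d w≤w' μ[w']≡true with reach-path R
    ... | p , p≤d , root≡μ = begin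
      eval M k μ w        ≡⟨ sym (spliced w) ⟩
      eval M k μ W        ≡⟨ sym (root≡μ W (onPath w)) ⟩
      eval M n root W     ≡⟨ Equivalence.from (represents W W≤d) sum[W]≤a0 ⟩
      true                ∎
      where
      open ≡-Reasoning
      c : ℕ
      c = suc (n ∸ k)

      W W' : ℕ → ℕ
      W  = splice c p w
      W' = splice c p w'

      spliced : ∀ u → eval M k μ (splice c p u) ≡ eval M k μ u
      spliced u = eval-local k μ (λ k' k'<k →
                    splice-≥ c p u (n ∸ k') (∸-monoʳ-< k'<k (reach-level-≤ R)))

      onPath : ∀ u j → j ≤ n ∸ k → splice c p u j ≡ p j
      onPath u j j≤ = splice-< c p u j (s≤s j≤)

      W'≤d : InDom d 1 n W'
      W'≤d = splice-InDom p≤d (λ j c≤j → w'≤d j (≤-trans (s≤s z≤n) c≤j))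

      W≤W' : InDom W' 1 n W
      W≤W' = splice-monoʳ c p w≤w'

      W≤d : InDom d 1 n W
      W≤d = InDom-trans W≤W' W'≤d

      root[W']≡true : eval M n root W' ≡ true
      root[W']≡true = trans (root≡μ W' (onPath w')) (trans (spliced w') μ[w']≡true)

      sum[W]≤a0 : + linSum n a W ≤ℤ a0
      sum[W]≤a0 = ℤ≤-trans (+≤+ (linSum-mono-≤ n a W≤W'))
                           (Equivalence.to (represents W' W'≤d) root[W']≡true)

    eval-child-true : ∀ {k} (ν : Inner k) {w} j → InDom d 1 n w → j ≤ w (n ∸ k) →
                      eval M (suc k) ν w ≡ true → eval M k (child ν j) w ≡ true
    eval-child-true {k} ν {w} j w≤d j≤w ν[w]≡true = begin
      eval M k (child ν j) w                  ≡⟨ eval-local k (child ν j) w≡w' ⟩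
      eval M k (child ν j) w'                 ≡⟨ cong (λ t → eval M k (child ν t) w')
                                                      (update-updates w (n ∸ k) j) ⟨
      eval M k (child ν (w' (n ∸ k))) w'      ≡⟨ eval-antitone (reachable k ν) w≤d
                                                      (update-≤ w (n ∸ k) j n j≤w) ν[w]≡true ⟩
      true                                    ∎
      where
      open ≡-Reasoning
      w' : ℕ → ℕ
      w' = update w (n ∸ k) j
      w≡w' : ∀ k' → k' < k → w (n ∸ k') ≡ w' (n ∸ k')
      w≡w' k' k'<k = sym (update-minimal w (n ∸ k) j (n ∸ k') λ eq →
        <⇒≢ (∸-monoʳ-< k'<k (<⇒≤ (reach-level-≤ (reachable k ν)))) (sym eq))

  _⊨_ : (Var M → Bool) → Lit M → Set
  σ ⊨ pos x = σ x ≡ true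
  σ ⊨ neg x = σ x ≡ false

  _⊨?_ : ∀ σ l → Dec (σ ⊨ l)
  σ ⊨? pos x = σ x ≟ᵇ true
  σ ⊨? neg x = σ x ≟ᵇ false

  ⊨-compl : ∀ σ l → σ ⊨ l → ¬ (σ ⊨ compl M l)
  ⊨-compl σ (pos x) σx≡true σx≡false with () ← trans (sym σx≡true) σx≡false
  ⊨-compl σ (neg x) σx≡false σx≡true with () ← trans (sym σx≡true) σx≡false

  UP-sound : ∀ {A σ} → (∀ {C} → Clause M C → Any (σ ⊨_) C) → (∀ {l} → A l → σ ⊨ l) →
             ∀ {l} → UP M A l → σ ⊨ l
  UP-sound F⊨ A⊨ (assumed Al) = A⊨ Al
  UP-sound {σ = σ} F⊨ A⊨ (propagate {l} C C∈F l∈C forced) with σ ⊨? l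
  ... | yes σ⊨l = σ⊨l
  ... | no σ⊭l with find (F⊨ C∈F)
  ...   | l' , l'∈C , σ⊨l' =
    ⊥-elim (⊨-compl σ l' σ⊨l' (UP-sound F⊨ A⊨ (forced l' l'∈C λ { refl → σ⊭l σ⊨l' })))

  valuation : (ℕ → ℕ) → Var M → Bool
  valuation w (y j k) = does (k ≤? w j)
  valuation w (z k μ) = eval M k μ w

  valuation-models-A : ∀ {i v w} → InDom w i n v → ∀ {l} → AssignA M i v l → valuation w ⊨ l
  valuation-models-A v≤w (setY j k i≤j j≤n _ k≤vj) = dec-true (k ≤? _) (≤-trans k≤vj (v≤w j i≤j j≤n))

  valuation-models-F : ∀ {a a0} → IsMDDOf M a a0 → ∀ {w} → InDom d 1 n w →
                       ∀ {C} → Clause M C → Any (valuation w ⊨_) C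
  valuation-models-F isM {w} w≤d (order j k _ _ _ _) with suc k ≤? w j
  ... | no k≮wj  = here (dec-false (suc k ≤? w j) k≮wj)
  ... | yes k<wj = there (here (dec-true (k ≤? w j) (<⇒≤ k<wj)))
  valuation-models-F isM w≤d unitT = here refl
  valuation-models-F isM w≤d unitF = here refl
  valuation-models-F isM {w} w≤d (edge0 {k} ν) with eval M (suc k) ν w in ν[w]
  ... | false = here ν[w]
  ... | true  = there (here (eval-child-true isM ν 0 w≤d z≤n ν[w]))
  valuation-models-F isM {w} w≤d (edge {k} ν j _ _) with eval M (suc k) ν w in ν[w]
  ... | false = here ν[w]
  ... | true with j ≤? w (n ∸ k)
  ...   | no j≰w  = there (here (dec-false (j ≤? w (n ∸ k)) j≰w))
  ...   | yes j≤w = there (there (here (eval-child-true isM ν j w≤d j≤w ν[w])))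

  UP-complete : ∀ {i v} → i ≤ n → InDom d i n v →
                ∀ k (μ : Lvl Inner k) → k ≤ suc (n ∸ i) →
                eval M k μ v ≡ false → UP M (AssignA M i v) (neg (z k μ))
  UP-complete i≤n v≤d zero false _ _ =
    propagate _ unitF (here refl) λ { _ (here refl) l≢l → ⊥-elim (l≢l refl) }
  UP-complete i≤n v≤d zero true _ ()
  UP-complete {i} {v} i≤n v≤d (suc k) ν sk≤ ν[v]≡false with v (n ∸ k) in v[n∸k]
  ... | zero  = propagate _ (edge0 ν) (here refl) λ
    { _ (here refl)         l≢l → ⊥-elim (l≢l refl)
    ; _ (there (here refl)) _   → UP-complete i≤n v≤d k (child ν 0) (m≤n⇒m≤1+n (s≤s⁻¹ sk≤)) ν[v]≡false }
  ... | suc m = propagate _ (edge ν (suc m) (s≤s z≤n) sm≤d) (here refl) λ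
    { _ (here refl)                 l≢l → ⊥-elim (l≢l refl)
    ; _ (there (here refl))         _   →
        assumed (setY (n ∸ k) (suc m) i≤n∸k (m∸n≤m n k) (s≤s z≤n) (≤-reflexive (sym v[n∸k])))
    ; _ (there (there (here refl))) _   →
        UP-complete i≤n v≤d k (child ν (suc m)) (m≤n⇒m≤1+n (s≤s⁻¹ sk≤)) ν[v]≡false }
    where
    i≤n∸k : i ≤ n ∸ k
    i≤n∸k = ∸-≤-swap i≤n (s≤s⁻¹ sk≤)
    sm≤d : suc m ≤ d (n ∸ k)
    sm≤d = subst (_≤ d (n ∸ k)) v[n∸k] (v≤d (n ∸ k) i≤n∸k (m∸n≤m n k))

-- Neither the positivity of the coefficients nor 1 ≤ i is needed: coefficients in ℕ
-- already make the constraint antitone.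
lemma1 : (n : ℕ) (d a : ℕ → ℕ) (a0 : ℤ) →
         (∀ j → 1 ≤ j → j ≤ n → 1 ≤ a j) →
         (M : MDD n d) → IsMDDOf M a a0 →
         (i : ℕ) → 1 ≤ i → i ≤ n →
         (v : ℕ → ℕ) → (∀ j → i ≤ j → j ≤ n → v j ≤ d j) →
         (ν : MDD.Inner M (n ∸ i)) →
         UP M (AssignA M i v) (neg (z (suc (n ∸ i)) ν)) ⇔ Incompatible M i v ν
lemma1 n d a a0 _ M isM i _ i≤n v v≤d ν = mk⇔ incompatible propagated
  where
  open MDDSemantics M

  incompatible : UP M (AssignA M i v) (neg (z (suc (n ∸ i)) ν)) → Incompatible M i v ν
  incompatible ⊢¬zν w v≤w w≤d ν[w]≡true = contradiction (trans (sym ν[w]≡true) ν[w]≡false) λ ()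
    where
    open ≡-Reasoning
    W : ℕ → ℕ
    W = splice i (λ _ → 0) w
    W≤d : InDom d 1 n W
    W≤d = splice-InDom (λ _ _ _ → z≤n) w≤d
    v≤W : InDom W i n v
    v≤W j i≤j j≤n = subst (v j ≤_) (sym (splice-≥ i (λ _ → 0) w j i≤j)) (v≤w j i≤j j≤n)
    ν[w]≡false : eval M (suc (n ∸ i)) ν w ≡ false
    ν[w]≡false = begin
      eval M (suc (n ∸ i)) ν w        ≡⟨ eval-local (suc (n ∸ i)) ν (λ k' k'≤ →
                                           splice-≥ i (λ _ → 0) w (n ∸ k') (∸-≤-swap i≤n (s≤s⁻¹ k'≤))) ⟨
      eval M (suc (n ∸ i)) ν W        ≡⟨ UP-sound (valuation-models-F isM W≤d) (valuation-models-A v≤W) ⊢¬zν ⟩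
      false                           ∎

  propagated : Incompatible M i v ν → UP M (AssignA M i v) (neg (z (suc (n ∸ i)) ν))
  propagated incompatible = UP-complete i≤n v≤d (suc (n ∸ i)) ν ≤-refl
                              (¬-not (incompatible v (λ _ _ _ → ≤-refl) v≤d))
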